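{- Let $T$ be a set of (not necessarily binary) rooted phylogenetic trees on the same leaf set $X$ with $h_t(T)\ge1$ and containing no leaf $x$ with $w_T(x)=0$. Let $\mathcal{N}$ be a network that displays every tree of $T$. Then $T$ has at most $2r(\mathcal{N})$ terminals whose parent in $\mathcal{N}$ is not a reticulation.
   Context: A (non-binary) tree on $X$ is a rooted tree whose non-leaf vertices have out-degree at least 2 and whose leaves are bijectively labelled by $X$. A cherry of $\mathcal{T}$ is the set of children of a vertex all of whose children are leaves. $N_{\mathcal{T}}(x)$ is the set of leaves $y\neq x$ in a common cherry with $x$; $N_T(x)=\bigcup_{\mathcal{T}\in T}N_{\mathcal{T}}(x)$. A neighbor cover of $x$ in $T$ is $S\subseteq N_T(x)$ with $S\cap N_{\mathcal{T}}(x)\neq\emptyset$ for all $\mathcal{T}\in T$; $w_T(x)$ is the minimum size of a neighbor cover minus one. A network on $X$ is a rooted acyclic digraph with root of in-degree 0 and out-degree $\ne1$, leaves (out-degree 0) exactly $X$, other vertices being tree vertices (in-degree 1, out-degree $\ge2$) or reticulations (out-degree 1, in-degree $\ge2$); arcs into reticulations are hybridization arcs, the rest tree arcs; $r(\mathcal{N})=\sum_{v\ne\rho}(d^-(v)-1)$. It is tree-child if every tree vertex has an outgoing tree arc, and temporal if it is tree-child and there is $t:V\to\mathbb{R}^+$ with $t(u)=t(v)$ for hybridization arcs $(u,v)$ and $t(u)<t(v)$ for tree arcs $(u,v)$. A network displays a binary tree if the tree is obtained by deleting arcs and vertices and suppressing in/out-degree-1 vertices; it displays a non-binary tree $\mathcal{T}$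 if it displays some binary refinement of $\mathcal{T}$. $h_t(T)$ is the minimum of $r(\mathcal{N})$ over temporal networks displaying all trees of $T$ ($\infty$ if none exists). Clusters of a tree are the leaf sets of subtrees of all vertices reachable from a vertex; $Cl(T)=\bigcup_{\mathcal{T}\in T}Cl(\mathcal{T})$; a cluster is trivial if it has one element. $x\xrightarrow{T}y$ if every nontrivial cluster in $Cl(T)$ containing $x$ contains $y$; $x$ is a terminal if there is no $y\ne x$ with $x\xrightarrow{T}y$. -}

module Defs where

open import Data.Nat using (ℕ; zero; suc; _+_; _*_; _∸_; _≤_)
open import Data.Bool using (Bool; true; false; if_then_else_)
open import Data.Fin using (Fin; _≟_)
open import Data.Fin.Subset using (Subset; _∈_; ∣_∣)
open import Data.List using (List; []; _∷_; map; allFin)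
open import Data.Nat.ListAction using (sum)
open import Data.Product using (Σ; ∃; ∃-syntax; _×_; _,_)
open import Data.Sum using (_⊎_)
open import Data.Rational using (ℚ; 0ℚ) renaming (_<_ to _<ℚ_)
open import Relation.Nullary using (¬_; does)
open import Relation.Binary.PropositionalEquality using (_≡_; _≢_)
open import Function.Bundles using (_⇔_)

-- Simple finite digraphs on vertex set Fin n, given by a Bool adjacency
-- relation  arc u v = true  iff (u,v) is an arc.

b2n : Bool → ℕ
b2n true  = 1
b2n false = 0

indeg : {n : ℕ} → (Fin n → Fin n → Bool) → Fin n → ℕ
indeg {n} arc v = sum (map (λ u → b2n (arc u v)) (allFin n))

outdeg : {n : ℕ} → (Fin n → Fin n → Bool) → Fin n → ℕ
outdeg {n} arc u = sum (map (λ v → b2n (arc u v)) (allFin n))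

data Reach {n : ℕ} (arc : Fin n → Fin n → Bool) : Fin n → Fin n → Set where
  here : ∀ {v} → Reach arc v v
  step : ∀ {u w v} → arc u w ≡ true → Reach arc w v → Reach arc u v

-- a directed path from u to v in which the internal vertices are listed
data PathVia {n : ℕ} (arc : Fin n → Fin n → Bool) : Fin n → Fin n → List (Fin n) → Set where
  edge : ∀ {u v} → arc u v ≡ true → PathVia arc u v []
  cons : ∀ {u w v vs} → arc u w ≡ true → PathVia arc w v vs → PathVia arc u v (w ∷ vs)

data _∈L_ {A : Set} (a : A) : List A → Set where
  hd : ∀ {xs} → a ∈L (a ∷ xs)
  tl : ∀ {b xs} → a ∈L xs → a ∈L (b ∷ xs)

record Network (m : ℕ) : Set where
  field
    n       : ℕ
    arc     : Fin n → Fin n → Bool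
    root    : Fin n
    leaf    : Fin m → Fin n
    leaf-inj  : ∀ x y → leaf x ≡ leaf y → x ≡ y
    leaf-out  : ∀ x → outdeg arc (leaf x) ≡ 0
    out0-leaf : ∀ v → outdeg arc v ≡ 0 → ∃[ x ] leaf x ≡ v
    acyclic   : ∀ u v → arc u v ≡ true → ¬ Reach arc v u
    root-in   : indeg arc root ≡ 0
    root-out  : outdeg arc root ≢ 1
    inner-type : ∀ v → v ≢ root → outdeg arc v ≢ 0 →
                 (indeg arc v ≡ 1 × 2 ≤ outdeg arc v) ⊎ (outdeg arc v ≡ 1 × 2 ≤ indeg arc v)
    leaf-in   : ∀ x → leaf x ≢ root → indeg arc (leaf x) ≡ 1

module _ {m : ℕ} (N : Network m) where
  open Network N

  IsReticulation : Fin n → Set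
  IsReticulation v = v ≢ root × outdeg arc v ≡ 1 × 2 ≤ indeg arc v

  IsTreeVertex : Fin n → Set
  IsTreeVertex v = v ≢ root × indeg arc v ≡ 1 × 2 ≤ outdeg arc v

  IsTreeArc : Fin n → Fin n → Set
  IsTreeArc u v = arc u v ≡ true × ¬ IsReticulation v

  IsHybArc : Fin n → Fin n → Set
  IsHybArc u v = arc u v ≡ true × IsReticulation v

  reticNum : ℕ
  reticNum = sum (map (λ v → if does (v ≟ root) then 0 else indeg arc v ∸ 1) (allFin n))

  TreeChild : Set
  TreeChild = ∀ u → IsTreeVertex u → ∃[ v ] IsTreeArc u v

  Temporal : Set
  Temporal = TreeChild ×
    (Σ (Fin n → ℚ) λ t → (∀ v → 0ℚ <ℚ t v)
       × (∀ u v → IsHybArc u v → t u ≡ t v)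
       × (∀ u v → IsTreeArc u v → t u <ℚ t v))

  ParentNotRetic : Fin m → Set
  ParentNotRetic x = ∀ p → arc p (leaf x) ≡ true → ¬ IsReticulation p

  InCluster : Fin n → Fin m → Set
  InCluster v x = Reach arc v (leaf x)

record Tree (m : ℕ) : Set where
  field
    net    : Network m
    isTree : ∀ v → indeg (Network.arc net) v ≤ 1

IsBinaryTree : {m : ℕ} → Tree m → Set
IsBinaryTree 𝒯 = ∀ v → outdeg arc v ≢ 0 → outdeg arc v ≡ 2
  where open Network (Tree.net 𝒯)

ClustersIncluded : {m : ℕ} → Tree m → Tree m → Set
ClustersIncluded 𝒯 ℬ =
  ∀ v → ∃[ w ] (∀ x → InCluster (Tree.net 𝒯) v x ⇔ InCluster (Tree.net ℬ) w x)

IsBinaryRefinement : {m : ℕ} → Tree m → Tree m → Set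
IsBinaryRefinement ℬ 𝒯 = IsBinaryTree ℬ × ClustersIncluded 𝒯 ℬ

-- N displays the binary tree ℬ: a subdivision of ℬ is a subgraph of N
-- (leaf labels preserved), i.e. ℬ arises from N by deleting arcs and
-- vertices and suppressing in/out-degree-1 vertices.
DisplaysBinary : {m : ℕ} → Network m → Tree m → Set
DisplaysBinary {m} N ℬ =
  Σ (Fin nB → Fin nN) λ φ →
  Σ (Fin nB → Fin nB → List (Fin nN)) λ inner →
      (∀ u v → φ u ≡ φ v → u ≡ v)
    × (∀ x → φ (leafB x) ≡ leafN x)
    × (∀ u v → arcB u v ≡ true → PathVia arcN (φ u) (φ v) (inner u v))
    × (∀ u v w → arcB u v ≡ true → w ∈L inner u v → ∀ z → φ z ≢ w)
    × (∀ u v u' v' w → arcB u v ≡ true → arcB u' v' ≡ true →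
         w ∈L inner u v → w ∈L inner u' v' → (u ≡ u' × v ≡ v'))
  where
    open Network N using () renaming (n to nN; arc to arcN; leaf to leafN)
    open Network (Tree.net ℬ) using () renaming (n to nB; arc to arcB; leaf to leafB)

Displays : {m : ℕ} → Network m → Tree m → Set
Displays N 𝒯 = ∃[ ℬ ] (IsBinaryRefinement ℬ 𝒯 × DisplaysBinary N ℬ)

DisplaysAll : {m k : ℕ} → Network m → (Fin k → Tree m) → Set
DisplaysAll N T = ∀ i → Displays N (T i)

-- h_t(T) ≥ 1 (including h_t(T) = ∞)
HtAtLeastOne : {m k : ℕ} → (Fin k → Tree m) → Set
HtAtLeastOne {m} T = ∀ (N : Network m) → Temporal N → DisplaysAll N T → 1 ≤ reticNum N

CherryNbr : {m : ℕ} → Tree m → Fin m → Fin m → Set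
CherryNbr 𝒯 x y = y ≢ x × ∃[ v ] (arc v (leaf x) ≡ true × arc v (leaf y) ≡ true
                                   × (∀ c → arc v c ≡ true → ∃[ z ] leaf z ≡ c))
  where open Network (Tree.net 𝒯)

CherryNbrAll : {m k : ℕ} → (Fin k → Tree m) → Fin m → Fin m → Set
CherryNbrAll T x y = ∃[ i ] CherryNbr (T i) x y

IsNeighborCover : {m k : ℕ} → (Fin k → Tree m) → Fin m → Subset m → Set
IsNeighborCover T x S =
  (∀ y → y ∈ S → CherryNbrAll T x y) × (∀ i → ∃[ y ] (y ∈ S × CherryNbr (T i) x y))

MinCoverSize : {m k : ℕ} → (Fin k → Tree m) → Fin m → ℕ → Set
MinCoverSize T x s = (∃[ S ] (IsNeighborCover T x S × ∣ S ∣ ≡ s))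
                   × (∀ S → IsNeighborCover T x S → s ≤ ∣ S ∣)

WEquals : {m k : ℕ} → (Fin k → Tree m) → Fin m → ℕ → Set
WEquals T x w = MinCoverSize T x (suc w)

NontrivialCluster : {m : ℕ} → (𝒯 : Tree m) → Fin (Network.n (Tree.net 𝒯)) → Set
NontrivialCluster 𝒯 v = ∃[ a ] ∃[ b ] (a ≢ b × InCluster (Tree.net 𝒯) v a × InCluster (Tree.net 𝒯) v b)

Arrow : {m k : ℕ} → (Fin k → Tree m) → Fin m → Fin m → Set
Arrow T x y = ∀ i v → NontrivialCluster (T i) v → InCluster (Tree.net (T i)) v x
                    → InCluster (Tree.net (T i)) v y

IsTerminal : {m k : ℕ} → (Fin k → Tree m) → Fin m → Set
IsTerminal T x = ¬ (∃[ y ] (y ≢ x × Arrow T x y))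

-- Theorem 18: if h_t(T) ≥ 1 and the network N displays every tree of T, then
-- T has at most 2 r(N) terminals whose parent in N is not a reticulation.
--
-- Let x be such a terminal with parent p.  Call v a tree descendant of p if v
-- is reached from p along a path that avoids leaf x and enters only vertices
-- of in-degree one.  (1) No leaf y is a tree descendant of p: in every
-- displayed binary refinement the embedded path down to y must pass through p,
-- which forces every nontrivial cluster containing x to contain y, i.e. x →_T y
-- (cluster-spreads, td-arrow).  (2) As p is not a reticulation it has a second
-- child, and walking down through tree descendants must therefore end in a
-- hybridization arc (u, c) (terminal-hybrid).  (3) Tree-descent paths that
-- meet merge, so distinct terminals yield distinct tails u (terminals-apart).
-- (4) Tails of hybridization arcs number at most Σ_c d⁻(c) over reticulations
-- c, which is at most 2 r(N) (tails-bound).  A leaf that is the root would make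
-- N a single vertex, temporal with r(N) = 0, which h_t(T) ≥ 1 excludes.

module Submission where

open import Data.Bool using (Bool; true; false; _∧_; if_then_else_)
open import Data.Empty using (⊥; ⊥-elim)
open import Data.Fin using (Fin; zero; suc)
open import Data.Fin.Induction using (spo-wellFounded)
open import Data.Fin.Properties using (suc-injective; 0≢1+n; _≟_)
open import Data.Fin.Subset using (Subset; _∈_; ∣_∣; inside; outside; _-_)
open import Data.Fin.Subset.Properties using (x∈p⇒∣p-x∣<∣p∣; x∈p∧x≢y⇒x∈p-y)
open import Data.List using (List; map; allFin)
open import Data.List.Properties using (map-tabulate)
import Data.Nat as ℕ
open import Data.Nat using (ℕ; zero; suc; _+_; _*_; _∸_; _≤_; z≤n; s≤s; s≤s⁻¹; _≤?_)
open import Data.Nat.ListAction using (sum)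
open import Data.Nat.Properties
  using (≤-trans; ≤-antisym; ≰⇒>; ≤∧≢⇒<; n≢0⇒n>0; n>0⇒n≢0; +-suc; m≤m+n; m≤n+m; +-mono-≤;
         +-0-commutativeMonoid; +-*-semiring; module ≤-Reasoning)
open import Algebra.Properties.Semiring.Sum +-*-semiring using (*-distribˡ-sum)
import Algebra.Properties.CommutativeMonoid.Sum +-0-commutativeMonoid as Σℕ
open Σℕ using (sum-syntax)
open import Data.Product using (∃-syntax; _×_; _,_; proj₁; proj₂)
open import Data.Rational using (1ℚ)
open import Data.Rational.Properties using (positive⁻¹)
open import Data.Sum using (_⊎_; inj₁; inj₂)
import Data.Vec as Vec
open import Data.Vec using (_∷_; []; here; there)
open import Data.Vec.Properties using (lookup⇒[]=; lookup∘tabulate)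
open import Function using (_∘_; id; flip)
open import Function.Bundles using (Equivalence)
open import Induction.WellFounded using (WellFounded; Acc; acc)
open import Relation.Binary.Construct.Flip.EqAndOrd as Flip using ()
open import Relation.Binary.PropositionalEquality
  using (_≡_; _≢_; refl; sym; trans; cong; subst; isEquivalence)
open import Relation.Binary.Structures using (IsStrictPartialOrder)
open import Relation.Nullary using (¬_; Dec; yes; no; does)
open import Relation.Nullary.Decidable using (dec-true)

open import Defs

listSum-suc : ∀ {n} (f : Fin (suc n) → ℕ) →
              sum (map f (allFin (suc n))) ≡ f zero + sum (map (f ∘ suc) (allFin n))
listSum-suc f = cong (λ xs → f zero + sum xs)
  (trans (map-tabulate suc f) (sym (map-tabulate id (f ∘ suc))))

listSum≡∑ : ∀ {n} (f : Fin n → ℕ) → sum (map f (allFin n)) ≡ ∑[ i < n ] f i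
listSum≡∑ {zero}  f = refl
listSum≡∑ {suc n} f = trans (listSum-suc f) (cong (f zero +_) (listSum≡∑ (f ∘ suc)))

count : ∀ {n} → (Fin n → Bool) → ℕ
count {n} f = sum (map (λ u → b2n (f u)) (allFin n))

count-suc : ∀ {n} (f : Fin (suc n) → Bool) → count f ≡ b2n (f zero) + count (f ∘ suc)
count-suc f = listSum-suc (b2n ∘ f)

count-pos : ∀ {n} (f : Fin n → Bool) {a} → f a ≡ true → 1 ≤ count f
count-pos f {zero}  fa rewrite count-suc f | fa = s≤s z≤n
count-pos f {suc a} fa rewrite count-suc f = ≤-trans (count-pos (f ∘ suc) fa) (m≤n+m _ _)

count-pair : ∀ {n} (f : Fin n → Bool) {a b} → a ≢ b → f a ≡ true → f b ≡ true → 2 ≤ count f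
count-pair f {zero}  {zero}  a≢b _  _  = ⊥-elim (a≢b refl)
count-pair f {zero}  {suc b} _   fa fb rewrite count-suc f | fa = s≤s (count-pos (f ∘ suc) fb)
count-pair f {suc a} {zero}  _   fa fb rewrite count-suc f | fb = s≤s (count-pos (f ∘ suc) fa)
count-pair f {suc a} {suc b} a≢b fa fb rewrite count-suc f =
  ≤-trans (count-pair (f ∘ suc) (a≢b ∘ cong suc) fa fb) (m≤n+m _ _)

count-witness : ∀ {n} (f : Fin n → Bool) → 1 ≤ count f → ∃[ a ] f a ≡ true
count-witness {zero}  f ()
count-witness {suc n} f 1≤c rewrite count-suc f with f zero in f0
... | true  = zero , f0
... | false = let (a , fa) = count-witness (f ∘ suc) 1≤c in suc a , fa

count-witnesses : ∀ {n} (f : Fin n → Bool) → 2 ≤ count f →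
                  ∃[ a ] ∃[ b ] (a ≢ b × f a ≡ true × f b ≡ true)
count-witnesses {zero}  f ()
count-witnesses {suc n} f 2≤c rewrite count-suc f with f zero in f0
... | true  = let (b , fb) = count-witness (f ∘ suc) (s≤s⁻¹ 2≤c) in zero , suc b , 0≢1+n , f0 , fb
... | false = let (a , b , a≢b , fa , fb) = count-witnesses (f ∘ suc) 2≤c
              in suc a , suc b , a≢b ∘ suc-injective , fa , fb

count-zero : ∀ {n} (f : Fin n → Bool) → count f ≡ 0 → ∀ a → f a ≢ true
count-zero f c≡0 a fa with () ← subst (1 ≤_) c≡0 (count-pos f fa)

count-one : ∀ {n} (f : Fin n → Bool) → count f ≡ 1 → ∀ {a b} → f a ≡ true → f b ≡ true → a ≡ b
count-one f c≡1 {a} {b} fa fb with a ≟ b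
... | yes a≡b = a≡b
... | no  a≢b with s≤s () ← subst (2 ≤_) c≡1 (count-pair f a≢b fa fb)

injection-≤ : ∀ {m n} (R : Fin m → Fin n → Set) (S : Subset m) (U : Subset n) →
              (∀ {x} → x ∈ S → ∃[ u ] (u ∈ U × R x u)) →
              (∀ {x y u} → x ∈ S → y ∈ S → R x u → R y u → x ≡ y) →
              ∣ S ∣ ≤ ∣ U ∣
injection-≤ R []            U image inj = z≤n
injection-≤ R (outside ∷ S) U image inj =
  injection-≤ (R ∘ suc) S U (image ∘ there)
    (λ x∈S y∈S rx ry → suc-injective (inj (there x∈S) (there y∈S) rx ry))
injection-≤ R (inside ∷ S) U image inj with image here
... | u₀ , u₀∈U , R0u₀ =
  ≤-trans (s≤s (injection-≤ (R ∘ suc) S (U - u₀) image′ inj′)) (x∈p⇒∣p-x∣<∣p∣ u₀∈U)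
  where
  -- no other element of S is related to u₀, so the rest of S maps into U - u₀
  image′ : ∀ {x} → x ∈ S → ∃[ u ] (u ∈ U - u₀ × R (suc x) u)
  image′ x∈S with image (there x∈S)
  ... | u , u∈U , Rxu = u , x∈p∧x≢y⇒x∈p-y u∈U u≢u₀ , Rxu
    where
    u≢u₀ : u ≢ u₀
    u≢u₀ refl = 0≢1+n (inj here (there x∈S) R0u₀ Rxu)
  inj′ : ∀ {x y u} → x ∈ S → y ∈ S → R (suc x) u → R (suc y) u → x ≡ y
  inj′ x∈S y∈S rx ry = suc-injective (inj (there x∈S) (there y∈S) rx ry)

∑-mono-≤ : ∀ {n} {f g : Fin n → ℕ} → (∀ i → f i ≤ g i) → ∑[ i < n ] f i ≤ ∑[ i < n ] g i
∑-mono-≤ {zero}  f≤g = z≤n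
∑-mono-≤ {suc n} f≤g = +-mono-≤ (f≤g zero) (∑-mono-≤ (f≤g ∘ suc))

∑-zero : ∀ n → ∑[ i < n ] 0 ≡ 0
∑-zero = Σℕ.sum-replicate-zero

≤-double-pred : ∀ {k} → 2 ≤ k → k ≤ 2 * (k ∸ 1)
≤-double-pred {suc zero}    (s≤s ())
≤-double-pred {suc (suc j)} _ =
  s≤s (subst (suc j ≤_) (sym (+-suc j (j + 0))) (s≤s (m≤m+n j (j + 0))))

∣tabulate∣ : ∀ {n} (f : Fin n → Bool) → ∣ Vec.tabulate f ∣ ≡ ∑[ i < n ] b2n (f i)
∣tabulate∣ {zero}  f = refl
∣tabulate∣ {suc n} f with f zero
... | true  = cong suc (∣tabulate∣ (f ∘ suc))
... | false = ∣tabulate∣ (f ∘ suc)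

module Paths {n : ℕ} {arc : Fin n → Fin n → Bool} where

  reach-trans : ∀ {u v w} → Reach arc u v → Reach arc v w → Reach arc u w
  reach-trans here         q = q
  reach-trans (step a r) q = step a (reach-trans r q)

  reach-last : ∀ {s t} → Reach arc s t → s ≡ t ⊎ ∃[ u ] (Reach arc s u × arc u t ≡ true)
  reach-last here = inj₁ refl
  reach-last (step a r) with reach-last r
  ... | inj₁ refl          = inj₂ (_ , here , a)
  ... | inj₂ (u , r′ , a′) = inj₂ (u , step a r′ , a′)

  path-reach : ∀ {s t vs} → PathVia arc s t vs → Reach arc s t
  path-reach (edge a)   = step a here
  path-reach (cons a p) = step a (path-reach p)

  path-penultimate : ∀ {s t vs} → PathVia arc s t vs →
                     arc s t ≡ true ⊎ ∃[ v ] (v ∈L vs × arc v t ≡ true)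
  path-penultimate (edge a) = inj₁ a
  path-penultimate (cons a p) with path-penultimate p
  ... | inj₁ a′           = inj₂ (_ , hd , a′)
  ... | inj₂ (v , v∈ , a′) = inj₂ (v , tl v∈ , a′)

  ClosedAbove : Fin n → (Fin n → Set) → Set
  ClosedAbove p Q = ∀ {s w} → Q w → arc s w ≡ true → w ≡ p ⊎ Q s

  path-back : ∀ {p Q} → ClosedAbove p Q → ∀ {s t vs} → PathVia arc s t vs → Q t →
              Q s ⊎ p ≡ t ⊎ p ∈L vs
  path-back closed (edge a) qt with closed qt a
  ... | inj₁ t≡p = inj₂ (inj₁ (sym t≡p))
  ... | inj₂ qs  = inj₁ qs
  path-back closed (cons a p) qt with path-back closed p qt
  ... | inj₂ (inj₁ p≡t) = inj₂ (inj₁ p≡t)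
  ... | inj₂ (inj₂ p∈)  = inj₂ (inj₂ (tl p∈))
  ... | inj₁ qw with closed qw a
  ...   | inj₁ refl = inj₂ (inj₂ hd)
  ...   | inj₂ qs   = inj₁ qs

module NetworkFacts {m : ℕ} (N : Network m) where
  open Network N
  open Paths {arc = arc}

  leaf-childless : ∀ x {w} → arc (leaf x) w ≢ true
  leaf-childless x = count-zero (arc (leaf x)) (leaf-out x) _

  root-parentless : ∀ {u} → arc u root ≢ true
  root-parentless = count-zero (λ u → arc u root) root-in _

  reach-from-leaf : ∀ x {v} → Reach arc (leaf x) v → v ≡ leaf x
  reach-from-leaf x here       = refl
  reach-from-leaf x (step a _) = ⊥-elim (leaf-childless x a)

  has-parent : ∀ {v} → v ≢ root → ∃[ u ] arc u v ≡ true
  has-parent {v} v≢root = count-witness (λ u → arc u v) indeg-pos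
    where
    indeg-pos : 1 ≤ indeg arc v
    indeg-pos with outdeg arc v ℕ.≟ 0
    ... | yes out≡0 with out0-leaf v out≡0
    ...   | x , refl = subst (1 ≤_) (sym (leaf-in x v≢root)) (s≤s z≤n)
    indeg-pos | no out≢0 with inner-type v v≢root out≢0
    ...   | inj₁ (in≡1 , _) = subst (1 ≤_) (sym in≡1) (s≤s z≤n)
    ...   | inj₂ (_ , 2≤in) = ≤-trans (s≤s z≤n) 2≤in

  sole-parent : ∀ {v s s′} → indeg arc v ≡ 1 → arc s v ≡ true → arc s′ v ≡ true → s ≡ s′
  sole-parent {v} in≡1 = count-one (λ u → arc u v) in≡1

  leaf-indeg : ∀ {p x} → arc p (leaf x) ≡ true → indeg arc (leaf x) ≡ 1
  leaf-indeg {x = x} px =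
    leaf-in x λ x≡root → root-parentless (subst (λ v → arc _ v ≡ true) x≡root px)

  leaf-parent : ∀ {p s x} → arc p (leaf x) ≡ true → arc s (leaf x) ≡ true → s ≡ p
  leaf-parent px sx = sole-parent (leaf-indeg px) sx px

  -- a parent p of x that is not a reticulation has a child other than leaf x,
  -- since p has out-degree at least two whether or not it is the root
  second-child : ∀ {p x} → ParentNotRetic N x → arc p (leaf x) ≡ true →
                 ∃[ c ] (arc p c ≡ true × c ≢ leaf x)
  second-child {p} {x} not-retic px with count-witnesses (arc p) two-children
    where
    one-child : 1 ≤ outdeg arc p
    one-child = count-pos (arc p) px
    two-children : 2 ≤ outdeg arc p
    two-children with p ≟ root
    ... | yes refl = ≤∧≢⇒< one-child (λ 1≡out → root-out (sym 1≡out))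
    ... | no p≢root with inner-type p p≢root (n>0⇒n≢0 one-child)
    ...   | inj₁ (_ , 2≤out)    = 2≤out
    ...   | inj₂ (out≡1 , 2≤in) = ⊥-elim (not-retic p px (p≢root , out≡1 , 2≤in))
  ... | c , c′ , c≢c′ , p↦c , p↦c′ with c ≟ leaf x
  ...   | no c≢x   = c , p↦c , c≢x
  ...   | yes refl = c′ , p↦c′ , c≢c′ ∘ sym

  _⇝⁺_ : Fin n → Fin n → Set
  u ⇝⁺ v = ∃[ w ] (arc u w ≡ true × Reach arc w v)

  ⇝⁺-isStrictPartialOrder : IsStrictPartialOrder _≡_ _⇝⁺_
  ⇝⁺-isStrictPartialOrder = record
    { isEquivalence = isEquivalence
    ; irrefl        = λ { refl (w , a , r) → acyclic _ w a r }
    ; trans         = λ { (w , a , r) (w′ , a′ , r′) → w , a , reach-trans r (step a′ r′) }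
    ; <-resp-≈      = (λ { refl → id }) , (λ { refl → id })
    }

  ancestors-wf : WellFounded _⇝⁺_
  ancestors-wf = spo-wellFounded ⇝⁺-isStrictPartialOrder

  descendants-wf : WellFounded (flip _⇝⁺_)
  descendants-wf = spo-wellFounded (Flip.isStrictPartialOrder ⇝⁺-isStrictPartialOrder)

  root-reaches : ∀ v → Reach arc root v
  root-reaches v = from-root v (ancestors-wf v)
    where
    -- climb to the root through parents, which are proper ancestors
    from-root : ∀ v → Acc _⇝⁺_ v → Reach arc root v
    from-root v (acc above) with v ≟ root
    ... | yes refl = here
    ... | no v≢root with has-parent v≢root
    ...   | u , a = reach-trans (from-root u (above (_ , a , here))) (step a here)

-- For the parent p of a leaf x, TreeDesc p x v says that v
-- is reached from p along a path that avoids leaf x and enters only vertices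
-- of in-degree one; such a v has a unique path back up to p.
module TreeDescendants {m : ℕ} (N : Network m) where
  open Network N
  open NetworkFacts N
  open Paths {arc = arc}

  data TreeDesc (p : Fin n) (x : Fin m) : Fin n → Set where
    start  : TreeDesc p x p
    extend : ∀ {a c} → TreeDesc p x a → arc a c ≡ true → c ≢ leaf x → indeg arc c ≡ 1 →
             TreeDesc p x c

  td-reach : ∀ {p x v} → TreeDesc p x v → Reach arc p v
  td-reach start             = here
  td-reach (extend td a _ _) = reach-trans (td-reach td) (step a here)

  td-closed : ∀ {p x} → ClosedAbove p (TreeDesc p x)
  td-closed start                 _ = inj₁ refl
  td-closed (extend td a _ in≡1) a′ with sole-parent in≡1 a′ a
  ... | refl = inj₂ td

  td-above-leaf : ∀ {p x v} → arc p (leaf x) ≡ true → TreeDesc p x v → Reach arc v (leaf x) → v ≡ p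
  td-above-leaf px start _ = refl
  td-above-leaf px (extend {a} {c} td a↦c c≢x _) c⇝x with reach-last c⇝x
  ... | inj₁ c≡x = ⊥-elim (c≢x c≡x)
  ... | inj₂ (s , c⇝s , sx) with leaf-parent px sx
  ...   | refl = ⊥-elim (acyclic a c a↦c (reach-trans c⇝s (td-reach td)))

  -- two tree-descent paths meeting in a vertex merge above it, since every
  -- vertex other than their starts has a single parent
  td-merge : ∀ {p x p′ x′ v} → TreeDesc p x v → TreeDesc p′ x′ v →
             TreeDesc p x p′ ⊎ TreeDesc p′ x′ p
  td-merge td    start = inj₁ td
  td-merge start td′   = inj₂ td′
  td-merge (extend td a _ in≡1) (extend td′ a′ _ _) with sole-parent in≡1 a a′
  ... | refl = td-merge td td′

module Embedding {m : ℕ} (N : Network m) (ℬ : Tree m) (D : DisplaysBinary N ℬ) where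
  open Network N
  open NetworkFacts N using (leaf-parent)
  open TreeDescendants N
  open Paths
  private
    module B where
      open Network (Tree.net ℬ) public
      open NetworkFacts (Tree.net ℬ) public using (root-reaches; reach-from-leaf)

  φ : Fin B.n → Fin n
  φ = proj₁ D

  inner : Fin B.n → Fin B.n → List (Fin n)
  inner = proj₁ (proj₂ D)

  φ-injective : ∀ u v → φ u ≡ φ v → u ≡ v
  φ-injective = proj₁ (proj₂ (proj₂ D))

  φ-leaf : ∀ x → φ (B.leaf x) ≡ leaf x
  φ-leaf = proj₁ (proj₂ (proj₂ (proj₂ D)))

  arc-path : ∀ u v → B.arc u v ≡ true → PathVia arc (φ u) (φ v) (inner u v)
  arc-path = proj₁ (proj₂ (proj₂ (proj₂ (proj₂ D))))

  inner-fresh : ∀ u v w → B.arc u v ≡ true → w ∈L inner u v → ∀ z → φ z ≢ w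
  inner-fresh = proj₁ (proj₂ (proj₂ (proj₂ (proj₂ (proj₂ D)))))

  inner-disjoint : ∀ u v u′ v′ w → B.arc u v ≡ true → B.arc u′ v′ ≡ true →
                   w ∈L inner u v → w ∈L inner u′ v′ → u ≡ u′ × v ≡ v′
  inner-disjoint = proj₂ (proj₂ (proj₂ (proj₂ (proj₂ (proj₂ D)))))

  φ-reach : ∀ {z t} → Reach B.arc z t → Reach arc (φ z) (φ t)
  φ-reach here       = here
  φ-reach (step a r) = reach-trans (path-reach (arc-path _ _ a)) (φ-reach r)

  MeetsAbove : Fin n → Fin B.n → Set
  MeetsAbove p t = (∃[ z ] (Reach B.arc z t × φ z ≡ p))
                 ⊎ (∃[ a ] ∃[ b ] (B.arc a b ≡ true × Reach B.arc b t × p ∈L inner a b))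

  walk-back : ∀ {p Q} → ClosedAbove {arc = arc} p Q → ∀ {z t} → Reach B.arc z t → Q (φ t) →
              Q (φ z) ⊎ MeetsAbove p t
  walk-back closed here qt = inj₁ qt
  walk-back closed (step {w = w} a r) qt with walk-back closed r qt
  ... | inj₂ meets = inj₂ meets
  ... | inj₁ qw with path-back closed (arc-path _ w a) qw
  ...   | inj₁ qz          = inj₁ qz
  ...   | inj₂ (inj₁ p≡φw) = inj₂ (inj₁ (w , r , sym p≡φw))
  ...   | inj₂ (inj₂ p∈)   = inj₂ (inj₂ (_ , w , a , r , p∈))

  into-leaf : ∀ {p x u} → arc p (leaf x) ≡ true → B.arc u (B.leaf x) ≡ true →
              φ u ≡ p ⊎ p ∈L inner u (B.leaf x)
  into-leaf {p} {x} {u} px u↦x with path-penultimate path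
    where
    path : PathVia arc (φ u) (leaf x) (inner u (B.leaf x))
    path = subst (λ t → PathVia arc (φ u) t (inner u (B.leaf x))) (φ-leaf x) (arc-path _ _ u↦x)
  ... | inj₁ a            = inj₁ (leaf-parent px a)
  ... | inj₂ (v , v∈ , a) = inj₂ (subst (_∈L inner u (B.leaf x)) (leaf-parent px a) v∈)

  td-meets : ∀ {p x y} → arc p (leaf x) ≡ true → TreeDesc p x (leaf y) → MeetsAbove p (B.leaf y)
  td-meets {p} {x} {y} px td with walk-back td-closed (B.root-reaches (B.leaf y))
                                              (subst (TreeDesc p x) (sym (φ-leaf y)) td)
  ... | inj₂ meets   = meets
  ... | inj₁ td-root = inj₁ (B.root , B.root-reaches _ , td-above-leaf px td-root root⇝x)
    where
    root⇝x : Reach arc (φ B.root) (leaf x)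
    root⇝x = subst (Reach arc (φ B.root)) (φ-leaf x) (φ-reach (B.root-reaches (B.leaf x)))

  -- If the image of the arc (u, leaf x) of ℬ and the path of ℬ down to leaf y
  -- both meet the same vertex p, then u lies above leaf y: two images can share
  -- p only at the same vertex of ℬ or inside the image of the same arc.
  shared-meeting : ∀ {p x y u} → B.arc u (B.leaf x) ≡ true →
                   φ u ≡ p ⊎ p ∈L inner u (B.leaf x) → MeetsAbove p (B.leaf y) →
                   Reach B.arc u (B.leaf y)
  shared-meeting {y = y} {u} _ (inj₁ φu≡p) (inj₁ (z , z⇝y , φz≡p)) =
    subst (λ v → Reach B.arc v (B.leaf y)) (φ-injective z u (trans φz≡p (sym φu≡p))) z⇝y
  shared-meeting {u = u} _ (inj₁ φu≡p) (inj₂ (a , b , a↦b , _ , p∈ab)) =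
    ⊥-elim (inner-fresh a b _ a↦b p∈ab u φu≡p)
  shared-meeting u↦x (inj₂ p∈ux) (inj₁ (z , _ , φz≡p)) =
    ⊥-elim (inner-fresh _ _ _ u↦x p∈ux z φz≡p)
  shared-meeting {x = x} {u = u} u↦x (inj₂ p∈ux) (inj₂ (a , b , a↦b , b⇝y , p∈ab))
    with inner-disjoint a b u _ _ a↦b u↦x p∈ab p∈ux
  ... | refl , refl = subst (Reach B.arc u) (sym (B.reach-from-leaf x b⇝y)) (step u↦x here)

  cluster-spreads : ∀ {p x y w} → arc p (leaf x) ≡ true → TreeDesc p x (leaf y) →
                    w ≢ B.leaf x → Reach B.arc w (B.leaf x) → Reach B.arc w (B.leaf y)
  cluster-spreads px td w≢x w⇝x with reach-last w⇝x
  ... | inj₁ w≡x             = ⊥-elim (w≢x w≡x)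
  ... | inj₂ (u , w⇝u , u↦x) =
    reach-trans w⇝u (shared-meeting u↦x (into-leaf px u↦x) (td-meets px td))

module Terminals {m k : ℕ} (T : Fin k → Tree m) (N : Network m) (disp : DisplaysAll N T) where
  open Network N
  open NetworkFacts N
  open TreeDescendants N

  -- x →_T y whenever leaf y is a tree descendant of x's parent p: every
  -- nontrivial cluster containing x is the cluster of a vertex w ≠ x of a
  -- displayed binary refinement, and w lies above y by cluster-spreads.
  td-arrow : ∀ {p x y} → arc p (leaf x) ≡ true → TreeDesc p x (leaf y) → Arrow T x y
  td-arrow {x = x} {y} px td i v (a , b , a≢b , v⇝a , v⇝b) v⇝x with disp i
  ... | ℬ , (_ , same-clusters) , D with same-clusters v
  ...   | w , same = from (same y) (cluster-spreads px td w≢x (to (same x) v⇝x))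
    where
    open Embedding N ℬ D using (cluster-spreads)
    open Equivalence using (to; from)
    module B = Network (Tree.net ℬ)
    open NetworkFacts (Tree.net ℬ) using () renaming (reach-from-leaf to B-reach-from-leaf)
    -- the cluster of w has the two elements a ≠ b, so w is not a leaf
    w≢x : w ≢ B.leaf x
    w≢x refl = a≢b (trans (B.leaf-inj a x (B-reach-from-leaf x (to (same a) v⇝a)))
                          (sym (B.leaf-inj b x (B-reach-from-leaf x (to (same b) v⇝b)))))

  terminal-leafless : ∀ {p x} → IsTerminal T x → arc p (leaf x) ≡ true →
                      ∀ y → ¬ TreeDesc p x (leaf y)
  terminal-leafless {x = x} term px y td with y ≟ x
  ... | no y≢x = term (y , y≢x , td-arrow px td)
  terminal-leafless {x = x} term px y start | yes refl = leaf-childless x px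
  terminal-leafless term px y (extend _ _ c≢x _) | yes refl = c≢x refl

  HybridBelow : Fin n → Fin m → Set
  HybridBelow p x = ∃[ u ] ∃[ c ] (TreeDesc p x u × arc u c ≡ true × 2 ≤ indeg arc c)

  -- Walking down from a tree descendant of p, every vertex reached is a
  -- reticulation (done), a leaf (excluded) or has a child to continue with;
  -- the walk ends since proper descent is well founded.
  descend : ∀ {p x a c} → arc p (leaf x) ≡ true → (∀ y → ¬ TreeDesc p x (leaf y)) →
            Acc (flip _⇝⁺_) c → TreeDesc p x a → arc a c ≡ true → c ≢ leaf x → HybridBelow p x
  descend {p} {x} {a} {c} px leafless (acc below) td a↦c c≢x with 2 ≤? indeg arc c
  ... | yes 2≤in = a , c , td , a↦c , 2≤in
  ... | no 2≰in = continue (outdeg arc c ℕ.≟ 0)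
    where
    -- c has in-degree one, so it is a tree descendant of p itself
    td-c : TreeDesc p x c
    td-c = extend td a↦c c≢x (≤-antisym (s≤s⁻¹ (≰⇒> 2≰in)) (count-pos (λ u → arc u c) a↦c))

    continue : Dec (outdeg arc c ≡ 0) → HybridBelow p x
    continue (yes out≡0) with out0-leaf c out≡0
    ... | y , y≡c = ⊥-elim (leafless y (subst (TreeDesc p x) (sym y≡c) td-c))
    continue (no out≢0) with count-witness (arc c) (n≢0⇒n>0 out≢0)
    ... | d , c↦d = descend px leafless (below (d , c↦d , here)) td-c c↦d d≢x
      where
      -- leaf x's only parent is p, which is not a proper descendant of itself
      d≢x : d ≢ leaf x
      d≢x refl = acyclic a c a↦c
                   (subst (λ v → Reach arc v a) (sym (leaf-parent px c↦d)) (td-reach td))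

  terminal-hybrid : ∀ {p x} → IsTerminal T x → ParentNotRetic N x → arc p (leaf x) ≡ true →
                    HybridBelow p x
  terminal-hybrid term not-retic px with second-child not-retic px
  ... | c , p↦c , c≢x = descend px (terminal-leafless term px) (descendants-wf c) start p↦c c≢x

  -- Distinct terminals have no common tree descendant below their parents:
  -- the two descent paths would merge, making one leaf a tree descendant of
  -- the other's parent.
  terminals-apart : ∀ {p p′ x x′ v} → x ≢ x′ → IsTerminal T x → IsTerminal T x′ →
                    arc p (leaf x) ≡ true → arc p′ (leaf x′) ≡ true →
                    TreeDesc p x v → TreeDesc p′ x′ v → ⊥
  terminals-apart {x = x} {x′} x≢x′ term term′ px px′ td td′ with td-merge td td′
  ... | inj₁ td-p′ = terminal-leafless term px x′
                       (extend td-p′ px′ (x≢x′ ∘ sym ∘ leaf-inj x′ x) (leaf-indeg px′))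
  ... | inj₂ td-p  = terminal-leafless term′ px′ x
                       (extend td-p px (x≢x′ ∘ leaf-inj x x′) (leaf-indeg px))

-- Each vertex c other than the root contributes
-- excess c = d⁻(c) − 1 to r(N), and a reticulation receives d⁻(c) ≤ 2·excess c
-- hybridization arcs, so the tails of hybridization arcs number at most 2 r(N).
module ReticulationCount {m : ℕ} (N : Network m) where
  open Network N
  open NetworkFacts N

  excess : Fin n → ℕ
  excess v = if does (v ≟ root) then 0 else indeg arc v ∸ 1

  reticNum≡∑excess : reticNum N ≡ ∑[ v < n ] excess v
  reticNum≡∑excess = listSum≡∑ excess

  hybrid : Fin n → Fin n → Bool
  hybrid u c = does (2 ≤? indeg arc c) ∧ arc u c

  tail? : Fin n → Bool
  tail? u = does (1 ≤? count (hybrid u))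

  HybridTails : Subset n
  HybridTails = Vec.tabulate tail?

  hybrid-tail : ∀ {u c} → arc u c ≡ true → 2 ≤ indeg arc c → u ∈ HybridTails
  hybrid-tail {u} {c} u↦c 2≤in = lookup⇒[]= u HybridTails
    (trans (lookup∘tabulate _ u) (dec-true (1 ≤? _) (count-pos (hybrid u) u↦c-hybrid)))
    where
    u↦c-hybrid : hybrid u c ≡ true
    u↦c-hybrid rewrite dec-true (2 ≤? indeg arc c) 2≤in = u↦c

  hybrid-in-bound : ∀ c → ∑[ u < n ] b2n (hybrid u c) ≤ 2 * excess c
  hybrid-in-bound c = bound (2 ≤? indeg arc c)
    where
    bound : (d : Dec (2 ≤ indeg arc c)) → ∑[ u < n ] b2n (does d ∧ arc u c) ≤ 2 * excess c
    bound (no _) = subst (_≤ 2 * excess c) (sym (∑-zero n)) z≤n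
    bound (yes 2≤in) with c ≟ root
    ... | yes refl with () ← subst (2 ≤_) root-in 2≤in
    ... | no _ = subst (_≤ 2 * (indeg arc c ∸ 1)) (listSum≡∑ (λ u → b2n (arc u c)))
                       (≤-double-pred 2≤in)

  tails-bound : ∣ HybridTails ∣ ≤ 2 * reticNum N
  tails-bound = begin
    ∣ HybridTails ∣                          ≡⟨ ∣tabulate∣ tail? ⟩
    ∑[ u < n ] b2n (tail? u)                ≤⟨ ∑-mono-≤ (λ u → indicator-≤ (count (hybrid u))) ⟩
    ∑[ u < n ] count (hybrid u)             ≡⟨ Σℕ.sum-cong-≗ (λ u → listSum≡∑ (b2n ∘ hybrid u)) ⟩
    ∑[ u < n ] ∑[ c < n ] b2n (hybrid u c)  ≡⟨ Σℕ.∑-comm (λ u c → b2n (hybrid u c)) ⟩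
    ∑[ c < n ] ∑[ u < n ] b2n (hybrid u c)  ≤⟨ ∑-mono-≤ hybrid-in-bound ⟩
    ∑[ c < n ] (2 * excess c)               ≡⟨ *-distribˡ-sum 2 excess ⟨
    2 * (∑[ c < n ] excess c)               ≡⟨ cong (2 *_) reticNum≡∑excess ⟨
    2 * reticNum N                          ∎
    where
    open ≤-Reasoning
    indicator-≤ : ∀ k → b2n (does (1 ≤? k)) ≤ k
    indicator-≤ zero    = z≤n
    indicator-≤ (suc k) = s≤s z≤n

  -- If a leaf is the root, N is a single vertex without arcs: it is temporal
  -- and has no reticulations.  Hence h_t(T) ≥ 1 rules this case out.
  root-leaf-trivial : ∀ x → leaf x ≡ root → Temporal N × reticNum N ≡ 0
  root-leaf-trivial x x≡root = temporal , no-reticulation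
    where
    all-root : ∀ v → v ≡ root
    all-root v =
      trans (reach-from-leaf x (subst (λ z → Reach arc z v) (sym x≡root) (root-reaches v))) x≡root
    no-arc : ∀ {u v} → arc u v ≢ true
    no-arc {u} = leaf-childless x ∘ subst (λ z → arc z _ ≡ true) (trans (all-root u) (sym x≡root))
    tree-child : TreeChild N
    tree-child u (u≢root , _) = ⊥-elim (u≢root (all-root u))
    -- constant time 1 works, as there are no arcs to check
    temporal : Temporal N
    temporal = tree-child , (λ _ → 1ℚ) , (λ _ → positive⁻¹ 1ℚ)
             , (λ _ _ h → ⊥-elim (no-arc (proj₁ h))) , (λ _ _ h → ⊥-elim (no-arc (proj₁ h)))
    no-excess : ∀ v → excess v ≡ 0
    no-excess v with v ≟ root
    ... | yes _     = refl
    ... | no v≢root = ⊥-elim (v≢root (all-root v))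
    no-reticulation : reticNum N ≡ 0
    no-reticulation = trans reticNum≡∑excess (trans (Σℕ.sum-cong-≗ no-excess) (∑-zero n))

mainTheorem18 : ∀ {m k : ℕ} (T : Fin k → Tree m) →
    HtAtLeastOne T →
    (∀ x → ¬ WEquals T x 0) →
    (N : Network m) → DisplaysAll N T →
    ∀ (S : Subset m) → (∀ x → x ∈ S → IsTerminal T x × ParentNotRetic N x) →
    ∣ S ∣ ≤ 2 * reticNum N
mainTheorem18 {m} T ht _ N disp S terminal =
  ≤-trans (injection-≤ TailBelow S HybridTails tail tails-distinct) tails-bound
  where
  open Network N
  open NetworkFacts N
  open TreeDescendants N
  open Terminals T N disp
  open ReticulationCount N

  leaf-not-root : ∀ x → leaf x ≢ root
  leaf-not-root x x≡root with root-leaf-trivial x x≡root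
  ... | temporal , r≡0 with () ← subst (1 ≤_) r≡0 (ht N temporal disp)

  TailBelow : Fin m → Fin n → Set
  TailBelow x u = ∃[ p ] (arc p (leaf x) ≡ true × TreeDesc p x u)

  tail : ∀ {x} → x ∈ S → ∃[ u ] (u ∈ HybridTails × TailBelow x u)
  tail {x} x∈S with has-parent (leaf-not-root x)
  ... | p , px with terminal-hybrid (proj₁ (terminal x x∈S)) (proj₂ (terminal x x∈S)) px
  ...   | u , c , td , u↦c , 2≤in = u , hybrid-tail u↦c 2≤in , p , px , td

  tails-distinct : ∀ {x y u} → x ∈ S → y ∈ S → TailBelow x u → TailBelow y u → x ≡ y
  tails-distinct {x} {y} x∈S y∈S (p , px , td) (q , qy , td′) with x ≟ y
  ... | yes x≡y = x≡y
  ... | no x≢y  =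
    ⊥-elim (terminals-apart x≢y (proj₁ (terminal x x∈S)) (proj₁ (terminal y y∈S)) px qy td td′)
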